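{- Let $a\in \mathbb{Z}_p\setminus \mathbb{Z}_{\leq 0}$, let $n\in\mathbb{Z}_{>0}$, and let $x, y\in\mathbb{Z}_{\geq 0}$ satisfy $x+y+a\equiv 0 \mod p^{n}$. Then $$ (-1)^{f_x}\frac{\{1\}_x}{\{a\}_x}\equiv (-1)^{f_y}\frac{\{1\}_y}{\{a\}_y} \mod p^{n}, $$ where $f_x=\ell_x-\lfloor \ell_x/p \rfloor$, $f_y=\ell_y-\lfloor \ell_y/p \rfloor$, and $\ell_x, \ell_y\in \{0,1,\cdots, q-1\}$ are the unique integers such that $x-\ell_x\equiv y-\ell_y\equiv 0 \mod q$.
   Context: Let $p$ be a prime and $\mathbb{Z}_p$ the $p$-adic integers. Put $q=4$ if $p=2$ and $q=p$ if $p\geq 3$. For $\alpha\in\mathbb{Z}_p$ and $n\in\mathbb{Z}_{\geq 1}$, define $\{\alpha\}_n=\prod_{1\leq i\leq n,\ p\nmid (\alpha+i-1)}(\alpha+i-1)$ (the product of the factors of the Pochhammer symbol $(\alpha)_n=\alpha(\alpha+1)\cdots(\alpha+n-1)$ that are not divisible by $p$), and $\{\alpha\}_0=1$. -}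

module Defs where

open import Data.Nat as ℕ using (ℕ; zero; suc; _^_; _%_; _/_; _≟_)
import Data.Nat.Divisibility as ℕD
open import Data.Integer as ℤ using (ℤ; +_; _+_; _-_; _*_; -_; ∣_∣; 0ℤ; 1ℤ)
open import Data.Integer.Properties using (+-inverseʳ)
open import Data.Integer.Divisibility using (_∣_)
open import Relation.Nullary using (yes; no)
open import Function using (it)
open import Relation.Binary.PropositionalEquality using (sym; subst)

-- p-adic integers ℤ_p, modelled as compatible sequences of integer
-- approximations: component k is a representative modulo p^k.
-- (Two sequences represent the same p-adic integer iff their k-th
-- components agree mod p^k for every k.)
record ℤ[_] (p : ℕ) : Set where
  constructor mkℤp
  field
    approx : ℕ → ℤ
    compat : ∀ k → (+ (p ^ k)) ∣ (approx (suc k) - approx k)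
open ℤ[_] public

ι : ∀ {p} → ℤ → ℤ[ p ]
ι {p} z = mkℤp (λ _ → z)
  (λ k → subst (λ t → ℕD._∣_ ∣ + (p ^ k) ∣ ∣ t ∣) (sym (+-inverseʳ z)) (ℕD._∣0 _))

_≡_[mod_^_] : ∀ {p} → ℤ[ p ] → ℤ[ p ] → ℕ → ℕ → Set
_≡_[mod_^_] {p} α β _ n = (+ (p ^ n)) ∣ (approx α n - approx β n)

-- Whether p divides α + i in ℤ_p (decided on the level-1 approximation,
-- i.e. on α mod p).
-- {α}_m computed at approximation level k: the product of the factors
-- α + i (0 ≤ i < m) of the Pochhammer symbol (α)_m that are not divisible by p.
curlyAt : (p : ℕ) → ℤ[ p ] → (k m : ℕ) → ℤ
curlyAt p α k zero = 1ℤ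
curlyAt p α k (suc m) with ℕD._∣?_ p ∣ approx α 1 + + m ∣
... | yes _ = curlyAt p α k m
... | no  _ = curlyAt p α k m * (approx α k + + m)

qOf : ℕ → ℕ
qOf 2 = 4
qOf p = p

qOf-nonZero : ∀ p → .{{ℕ.NonZero p}} → ℕ.NonZero (qOf p)
qOf-nonZero (suc zero) = _
qOf-nonZero (suc (suc zero)) = _
qOf-nonZero (suc (suc (suc _))) = _

ℓOf : (p x : ℕ) .{{_ : ℕ.NonZero p}} → ℕ
ℓOf p x = ℕ._%_ x (qOf p) {{qOf-nonZero p}}

fOf : (p x : ℕ) .{{_ : ℕ.NonZero p}} → ℕ
fOf p x = ℓOf p x ℕ.∸ (ℓOf p x / p)

sgn : ℕ → ℤ
sgn zero = 1ℤ
sgn (suc f) = - sgn f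

-- Since a ≡ -(x + y) (mod p^n), the factor a + i of {a}_y is congruent to -(x + y - i),
-- and as p ∣ p^n the same factors are skipped; so {a}_y ≡ ∏_{x < j ≤ x + y, p ∤ j} (-j).
-- Moreover (-1)^{f_x} = (-1)^{#{1 ≤ j ≤ x : p ∤ j}}: that count changes parity exactly
-- like ℓ_x - ⌊ℓ_x / p⌋, with period q.  Hence both sides of the congruence are
-- ≡ ∏_{1 ≤ j ≤ x + y, p ∤ j} (-j).
module Submission where

open import Defs
open import Data.Nat using (ℕ; zero; suc; _^_; _≥_; NonZero)
import Data.Nat as ℕ
import Data.Nat.Properties as ℕP
import Data.Nat.Divisibility as ℕD
import Data.Nat.DivMod as ℕM
open import Data.Nat.Primality using (Prime; composite; ¬prime[1])
open import Data.Integer using (ℤ; +_; _+_; _-_; _*_; -_; 0ℤ; 1ℤ; -1ℤ; ∣_∣)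
import Data.Integer.Properties as ℤP
open import Data.Integer.Divisibility using (_∣_)
import Data.Integer.Divisibility.Signed as S
open import Data.Integer.Tactic.RingSolver using (solve-∀)
open import Data.Product using (∃)
open import Data.Sum using (_⊎_; inj₁; inj₂)
open import Data.Empty using (⊥-elim)
open import Relation.Nullary using (¬_; Dec; yes; no)
open import Relation.Binary.Bundles using (Setoid)
open import Relation.Binary.PropositionalEquality

module Congruence (N : ℤ) where

  infix 4 _≈_
  record _≈_ (a b : ℤ) : Set where
    constructor fromDivides
    field
      divides : N S.∣ (a - b)
  open _≈_ public

  ≈-reflexive : ∀ {a b} → a ≡ b → a ≈ b
  ≈-reflexive {a} refl = fromDivides (S.divides 0ℤ (trans (ℤP.+-inverseʳ a) (sym (ℤP.*-zeroˡ N))))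

  ≈-sym : ∀ {a b} → a ≈ b → b ≈ a
  ≈-sym {a} {b} (fromDivides N∣a-b) = fromDivides (subst (N S.∣_) (negate a b) (S.∣m⇒∣-m N∣a-b))
    where
    negate : ∀ a b → - (a - b) ≡ b - a
    negate = solve-∀

  ≈-trans : ∀ {a b c} → a ≈ b → b ≈ c → a ≈ c
  ≈-trans {a} {b} {c} (fromDivides N∣a-b) (fromDivides N∣b-c) =
    fromDivides (subst (N S.∣_) (telescope a b c) (S.∣m∣n⇒∣m+n N∣a-b N∣b-c))
    where
    telescope : ∀ a b c → (a - b) + (b - c) ≡ a - c
    telescope = solve-∀

  *-cong : ∀ {a a′ b b′} → a ≈ a′ → b ≈ b′ → a * b ≈ a′ * b′
  *-cong {a} {a′} {b} {b′} (fromDivides N∣a-a′) (fromDivides N∣b-b′) =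
    fromDivides (subst (N S.∣_) (expand a a′ b b′)
                       (S.∣m∣n⇒∣m+n (S.∣m⇒∣m*n b N∣a-a′) (S.∣n⇒∣m*n a′ N∣b-b′)))
    where
    expand : ∀ a a′ b b′ → (a - a′) * b + a′ * (b - b′) ≡ a * b - a′ * b′
    expand = solve-∀

  ≈-setoid : Setoid _ _
  ≈-setoid = record
    { Carrier = ℤ
    ; _≈_ = _≈_
    ; isEquivalence = record
      { refl = λ {a} → ≈-reflexive {a} refl
      ; sym = λ {a} {b} → ≈-sym {a} {b}
      ; trans = λ {a} {b} {c} → ≈-trans {a} {b} {c}
      }
    }

omitIf : {P : Set} → Dec P → ℤ → ℤ
omitIf (yes _) v = 1ℤ
omitIf (no _)  v = v

omitIf-neg : ∀ {P : Set} (D : Dec P) v → omitIf D (- v) ≡ omitIf D -1ℤ * omitIf D v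
omitIf-neg (yes _) v = refl
omitIf-neg (no _)  v = sym (ℤP.-1*i≡-i v)

module _ {N : ℤ} where
  open Congruence N

  omitIf-cong : ∀ {P Q : Set} (D : Dec P) (E : Dec Q) {v v′} →
                (P → Q) → (Q → P) → v ≈ v′ → omitIf D v ≈ omitIf E v′
  omitIf-cong (yes _) (yes _) _   _   _    = ≈-reflexive {1ℤ} refl
  omitIf-cong (no _)  (no _)  _   _   v≈v′ = v≈v′
  omitIf-cong (yes P) (no ¬Q) P→Q _   _    = ⊥-elim (¬Q (P→Q P))
  omitIf-cong (no ¬P) (yes Q) _   Q→P _    = ⊥-elim (¬P (Q→P Q))

module Prod∤ (p : ℕ) where

  factor∤ : ℤ → ℤ → ℤ
  factor∤ t v = omitIf (p ℕD.∣? ∣ t ∣) v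

  -- prod∤ g d b m = ∏_{i < m, p ∤ d + i} g (b + i).  Divisibility is tested on d and
  -- the factors are taken from b, as curlyAt tests α mod p but multiplies level-k
  -- approximations.
  prod∤ : (ℤ → ℤ) → ℤ → ℤ → ℕ → ℤ
  prod∤ g d b zero    = 1ℤ
  prod∤ g d b (suc m) = prod∤ g d b m * factor∤ (d + + m) (g (b + + m))

  curlyAt≡prod∤ : ∀ (α : ℤ[ p ]) k m → curlyAt p α k m ≡ prod∤ (λ v → v) (approx α 1) (approx α k) m
  curlyAt≡prod∤ α k zero = refl
  curlyAt≡prod∤ α k (suc m) with p ℕD.∣? ∣ approx α 1 + + m ∣
  ... | yes _ = trans (curlyAt≡prod∤ α k m) (sym (ℤP.*-identityʳ _))
  ... | no _  = cong (_* (approx α k + + m)) (curlyAt≡prod∤ α k m)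

  prod∤-+ : ∀ g d b m k → prod∤ g d b (m ℕ.+ k) ≡ prod∤ g d b m * prod∤ g (d + + m) (b + + m) k
  prod∤-+ g d b m zero rewrite ℕP.+-identityʳ m = sym (ℤP.*-identityʳ _)
  prod∤-+ g d b m (suc k) rewrite ℕP.+-suc m k = begin
      prod∤ g d b (m ℕ.+ k) * factor∤ (d + + (m ℕ.+ k)) (g (b + + (m ℕ.+ k)))
    ≡⟨ cong₂ _*_ (prod∤-+ g d b m k)
                 (cong₂ (λ t v → factor∤ t (g v)) (sym (ℤP.+-assoc d (+ m) (+ k)))
                                                  (sym (ℤP.+-assoc b (+ m) (+ k)))) ⟩
      prod∤ g d b m * prod∤ g (d + + m) (b + + m) k * factor∤ (d + + m + + k) (g (b + + m + + k))
    ≡⟨ ℤP.*-assoc (prod∤ g d b m) _ _ ⟩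
      prod∤ g d b m * prod∤ g (d + + m) (b + + m) (suc k) ∎
    where open ≡-Reasoning

  prod∤-sucˡ : ∀ g d b m → prod∤ g d b (suc m) ≡ factor∤ d (g b) * prod∤ g (1ℤ + d) (1ℤ + b) m
  prod∤-sucˡ g d b m = begin
      prod∤ g d b (1 ℕ.+ m)
    ≡⟨ prod∤-+ g d b 1 m ⟩
      1ℤ * factor∤ (d + 0ℤ) (g (b + 0ℤ)) * prod∤ g (d + 1ℤ) (b + 1ℤ) m
    ≡⟨ cong₂ _*_ (trans (ℤP.*-identityˡ _)
                        (cong₂ (λ t v → factor∤ t (g v)) (ℤP.+-identityʳ d) (ℤP.+-identityʳ b)))
                 (cong₂ (λ d′ b′ → prod∤ g d′ b′ m) (ℤP.+-comm d 1ℤ) (ℤP.+-comm b 1ℤ)) ⟩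
      factor∤ d (g b) * prod∤ g (1ℤ + d) (1ℤ + b) m ∎
    where open ≡-Reasoning

  prod∤-neg : ∀ d b m → prod∤ -_ d b m ≡ prod∤ (λ _ → -1ℤ) d b m * prod∤ (λ v → v) d b m
  prod∤-neg d b zero    = refl
  prod∤-neg d b (suc m) = begin
      prod∤ -_ d b m * omitIf D (- (b + + m))
    ≡⟨ cong₂ _*_ (prod∤-neg d b m) (omitIf-neg D (b + + m)) ⟩
      (prod∤ (λ _ → -1ℤ) d b m * prod∤ (λ v → v) d b m) * (omitIf D -1ℤ * omitIf D (b + + m))
    ≡⟨ interchange (prod∤ (λ _ → -1ℤ) d b m) (prod∤ (λ v → v) d b m)
                   (omitIf D -1ℤ) (omitIf D (b + + m)) ⟩
      (prod∤ (λ _ → -1ℤ) d b m * omitIf D -1ℤ) * (prod∤ (λ v → v) d b m * omitIf D (b + + m)) ∎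
    where
    open ≡-Reasoning
    D = p ℕD.∣? ∣ d + + m ∣
    interchange : ∀ a b c e → (a * b) * (c * e) ≡ (a * c) * (b * e)
    interchange = solve-∀

  factor∤-cong : ∀ {N t t′ v v′} → + p S.∣ (t + t′) → Congruence._≈_ N v v′ →
                 Congruence._≈_ N (factor∤ t v) (factor∤ t′ v′)
  factor∤-cong {t = t} {t′} p∣t+t′ =
    omitIf-cong (p ℕD.∣? ∣ t ∣) (p ℕD.∣? ∣ t′ ∣)
      (λ p∣t → S.∣⇒∣ᵤ {+ p} {t′} (S.∣m+n∣m⇒∣n p∣t+t′ (S.∣ᵤ⇒∣ {+ p} {t} p∣t)))
      (λ p∣t′ → S.∣⇒∣ᵤ {+ p} {t} (S.∣m+n∣n⇒∣m p∣t+t′ (S.∣ᵤ⇒∣ {+ p} {t′} p∣t′)))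

  -- Modulo N the factor b + i equals -(e + m - i), so the left product is the right
  -- one read backwards; p ∣ N makes both skip the same factors.
  prod∤-reflect : ∀ {N d b} → + p S.∣ N → + p S.∣ (b - d) → ∀ m e → N S.∣ (b + + m + e) →
                  Congruence._≈_ N (prod∤ (λ v → v) d b m) (prod∤ -_ (1ℤ + e) (1ℤ + e) m)
  prod∤-reflect {N} _ _ zero e _ = Congruence.≈-reflexive N {1ℤ} refl
  prod∤-reflect {N} {d} {b} p∣N p∣b-d (suc m) e N∣b+m+e = begin
      prod∤ (λ v → v) d b m * factor∤ (d + + m) (b + + m)
    ≈⟨ *-cong (prod∤-reflect p∣N p∣b-d m (1ℤ + e) (subst (N S.∣_) (shift b (+ m) e) N∣b+m+e))
              (factor∤-cong {t = d + + m} {1ℤ + e} p∣t+t′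
                            (fromDivides (subst (N S.∣_) (outer b (+ m) e) N∣b+m+e))) ⟩
      prod∤ -_ (1ℤ + (1ℤ + e)) (1ℤ + (1ℤ + e)) m * factor∤ (1ℤ + e) (- (1ℤ + e))
    ≡⟨ ℤP.*-comm (prod∤ -_ (1ℤ + (1ℤ + e)) (1ℤ + (1ℤ + e)) m) _ ⟩
      factor∤ (1ℤ + e) (- (1ℤ + e)) * prod∤ -_ (1ℤ + (1ℤ + e)) (1ℤ + (1ℤ + e)) m
    ≡⟨ prod∤-sucˡ -_ (1ℤ + e) (1ℤ + e) m ⟨
      prod∤ -_ (1ℤ + e) (1ℤ + e) (suc m) ∎
    where
    open Congruence N
    open import Relation.Binary.Reasoning.Setoid ≈-setoid
    shift : ∀ b M e → b + (1ℤ + M) + e ≡ b + M + (1ℤ + e)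
    shift = solve-∀
    outer : ∀ b M e → b + (1ℤ + M) + e ≡ (b + M) - - (1ℤ + e)
    outer = solve-∀
    index : ∀ b d M e → (b + (1ℤ + M) + e) - (b - d) ≡ (d + M) + (1ℤ + e)
    index = solve-∀
    p∣t+t′ : + p S.∣ ((d + + m) + (1ℤ + e))
    p∣t+t′ = subst (+ p S.∣_) (index b d (+ m) e)
               (S.∣m∣n⇒∣m-n (S.∣-trans p∣N N∣b+m+e) p∣b-d)

  sign∤ : ℕ → ℤ
  sign∤ = prod∤ (λ _ → -1ℤ) 1ℤ 1ℤ

sgn-even : ∀ k → ¬ 2 ℕD.∣ suc k → sgn k ≡ 1ℤ
sgn-even zero          _      = refl
sgn-even (suc zero)    2∤2    = ⊥-elim (2∤2 ℕD.∣-refl)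
sgn-even (suc (suc k)) 2∤3+k  =
  trans (ℤP.neg-involutive (sgn k)) (sgn-even k (λ 2∣1+k → 2∤3+k (ℕD.∣m∣n⇒∣m+n (ℕD.∣-refl {2}) 2∣1+k)))

module OddPrime (k : ℕ) (isPrime : Prime (3 ℕ.+ k)) where
  p : ℕ
  p = 3 ℕ.+ k

  open Prod∤ p

  2∤p : ¬ 2 ℕD.∣ p
  2∤p 2∣p = Prime.notComposite isPrime (composite {2} (ℕ.s≤s (ℕ.s≤s (ℕ.s≤s ℕ.z≤n))) 2∣p)

  %-suc : ∀ x → ¬ p ℕD.∣ suc x → suc x ℕ.% p ≡ suc (x ℕ.% p)
  %-suc x p∤1+x with ℕP.m≤n⇒m<n∨m≡n (ℕM.m%n<n x p)
  ... | inj₁ 1+x%p<p = trans (ℕM.%-distribˡ-+ 1 x p) (ℕM.m<n⇒m%n≡m 1+x%p<p)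
  ... | inj₂ 1+x%p≡p = ⊥-elim (p∤1+x (ℕD.m%n≡0⇒n∣m (suc x) p
          (trans (ℕM.%-distribˡ-+ 1 x p) (trans (cong (ℕ._% p) 1+x%p≡p) (ℕM.n%n≡0 p)))))

  -- At a multiple of p the residue drops from p - 1 to 0, which is even since p is odd.
  sgn-%-suc : ∀ x (D : Dec (p ℕD.∣ suc x)) → sgn (suc x ℕ.% p) ≡ sgn (x ℕ.% p) * omitIf D -1ℤ
  sgn-%-suc x (yes p∣1+x) = begin
      sgn (suc x ℕ.% p)  ≡⟨ cong sgn (ℕD.n∣m⇒m%n≡0 (suc x) p p∣1+x) ⟩
      1ℤ                 ≡⟨ sgn-even (2 ℕ.+ k) 2∤p ⟨
      sgn (2 ℕ.+ k)      ≡⟨ cong sgn (ℕM.%-pred-≡0 {x} {p} (ℕD.n∣m⇒m%n≡0 (suc x) p p∣1+x)) ⟨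
      sgn (x ℕ.% p)      ≡⟨ ℤP.*-identityʳ (sgn (x ℕ.% p)) ⟨
      sgn (x ℕ.% p) * 1ℤ ∎
    where open ≡-Reasoning
  sgn-%-suc x (no p∤1+x) = begin
      sgn (suc x ℕ.% p)      ≡⟨ cong sgn (%-suc x p∤1+x) ⟩
      - sgn (x ℕ.% p)        ≡⟨ ℤP.-1*i≡-i (sgn (x ℕ.% p)) ⟨
      -1ℤ * sgn (x ℕ.% p)    ≡⟨ ℤP.*-comm -1ℤ (sgn (x ℕ.% p)) ⟩
      sgn (x ℕ.% p) * -1ℤ ∎
    where open ≡-Reasoning

  sgn-%≡sign∤ : ∀ x → sgn (x ℕ.% p) ≡ sign∤ x
  sgn-%≡sign∤ zero    = refl
  sgn-%≡sign∤ (suc x) =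
    trans (sgn-%-suc x (p ℕD.∣? suc x)) (cong (_* omitIf (p ℕD.∣? suc x) -1ℤ) (sgn-%≡sign∤ x))

  sgn-fOf≡sign∤ : ∀ x → sgn (fOf p x) ≡ sign∤ x
  sgn-fOf≡sign∤ x =
    trans (cong (λ t → sgn (x ℕ.% p ℕ.∸ t)) (ℕM.m<n⇒m/n≡0 (ℕM.m%n<n x p))) (sgn-%≡sign∤ x)

module EvenPrime where
  open Prod∤ 2

  2∣n⊎2∣1+n : ∀ n → 2 ℕD.∣ n ⊎ 2 ℕD.∣ suc n
  2∣n⊎2∣1+n zero = inj₁ (2 ℕD.∣0)
  2∣n⊎2∣1+n (suc n) with 2∣n⊎2∣1+n n
  ... | inj₁ 2∣n   = inj₂ (ℕD.∣m∣n⇒∣m+n (ℕD.∣-refl {2}) 2∣n)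
  ... | inj₂ 2∣1+n = inj₁ 2∣1+n

  2∣n⇒2∤1+n : ∀ n → 2 ℕD.∣ n → ¬ 2 ℕD.∣ suc n
  2∣n⇒2∤1+n n 2∣n 2∣1+n with ℕD.∣1⇒≡1 (ℕD.∣m+n∣m⇒∣n (subst (2 ℕD.∣_) (ℕP.+-comm 1 n) 2∣1+n) 2∣n)
  ... | ()

  omitIf-consecutive : ∀ n (D : Dec (2 ℕD.∣ n)) (E : Dec (2 ℕD.∣ suc n)) →
                       omitIf D -1ℤ * omitIf E -1ℤ ≡ -1ℤ
  omitIf-consecutive n (yes 2∣n) (yes 2∣1+n) = ⊥-elim (2∣n⇒2∤1+n n 2∣n 2∣1+n)
  omitIf-consecutive n (yes _)   (no _)       = refl
  omitIf-consecutive n (no _)    (yes _)      = refl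
  omitIf-consecutive n (no 2∤n)  (no 2∤1+n) with 2∣n⊎2∣1+n n
  ... | inj₁ 2∣n   = ⊥-elim (2∤n 2∣n)
  ... | inj₂ 2∣1+n = ⊥-elim (2∤1+n 2∣1+n)

  sign∤-periodic : ∀ x → sign∤ (4 ℕ.+ x) ≡ sign∤ x
  sign∤-periodic x = begin
      sign∤ x * s 1 * s 2 * s 3 * s 4       ≡⟨ regroup (sign∤ x) (s 1) (s 2) (s 3) (s 4) ⟩
      sign∤ x * (s 1 * s 2) * (s 3 * s 4)   ≡⟨ cong₂ (λ u v → sign∤ x * u * v)
                                                     (omitIf-consecutive (1 ℕ.+ x) (dec 1) (dec 2))
                                                     (omitIf-consecutive (3 ℕ.+ x) (dec 3) (dec 4)) ⟩
      sign∤ x * -1ℤ * -1ℤ                   ≡⟨ cancel (sign∤ x) ⟩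
      sign∤ x                               ∎
    where
    open ≡-Reasoning
    dec : ∀ i → Dec (2 ℕD.∣ i ℕ.+ x)
    dec i = 2 ℕD.∣? (i ℕ.+ x)
    s : ℕ → ℤ
    s i = omitIf (dec i) -1ℤ
    regroup : ∀ a b c d e → a * b * c * d * e ≡ a * (b * c) * (d * e)
    regroup = solve-∀
    cancel : ∀ a → a * -1ℤ * -1ℤ ≡ a
    cancel = solve-∀

  sgn-fOf≡sign∤ : ∀ x → sgn (fOf 2 x) ≡ sign∤ x
  sgn-fOf≡sign∤ 0 = refl
  sgn-fOf≡sign∤ 1 = refl
  sgn-fOf≡sign∤ 2 = refl
  sgn-fOf≡sign∤ 3 = refl
  sgn-fOf≡sign∤ (suc (suc (suc (suc x)))) = trans (sgn-fOf≡sign∤ x) (sym (sign∤-periodic x))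

sgn-fOf≡sign∤ : ∀ p .{{_ : NonZero p}} → Prime p → ∀ x → sgn (fOf p x) ≡ Prod∤.sign∤ p x
sgn-fOf≡sign∤ 1                   isPrime = ⊥-elim (¬prime[1] isPrime)
sgn-fOf≡sign∤ 2                   _       = EvenPrime.sgn-fOf≡sign∤
sgn-fOf≡sign∤ (suc (suc (suc k))) isPrime = OddPrime.sgn-fOf≡sign∤ k isPrime

approx≡approx₁-mod-p : ∀ {p} (α : ℤ[ p ]) k → + p S.∣ (approx α (suc k) - approx α 1)
approx≡approx₁-mod-p {p} α k = divides (approx≈approx₁ k)
  where
  open Congruence (+ p)
  approx≈approx₁ : ∀ k → approx α (suc k) ≈ approx α 1
  approx≈approx₁ zero    = ≈-reflexive refl
  approx≈approx₁ (suc k) = ≈-trans (fromDivides p∣step) (approx≈approx₁ k)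
    where
    p∣step : + p S.∣ (approx α (2 ℕ.+ k) - approx α (suc k))
    p∣step = S.∣-trans (S.∣ᵤ⇒∣ {+ p} {+ (p ^ suc k)} (ℕD.m∣m*n (p ^ k))) (S.∣ᵤ⇒∣ (compat α (suc k)))

module _ (p : ℕ) .{{_ : NonZero p}} (isPrime : Prime p) (a : ℤ[ p ]) (k : ℕ) {N : ℤ} (p∣N : + p S.∣ N) where
  open Prod∤ p
  open Congruence N

  signed-curly≈prod∤ : ∀ u v → N S.∣ (approx a (suc k) + + v + + u) →
    sgn (fOf p u) * curlyAt p (ι (+ 1)) (suc k) u * curlyAt p a (suc k) v ≈ prod∤ -_ 1ℤ 1ℤ (u ℕ.+ v)
  signed-curly≈prod∤ u v N∣a+v+u = begin
      sgn (fOf p u) * curlyAt p (ι (+ 1)) (suc k) u * curlyAt p a (suc k) v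
    ≡⟨ cong₂ (λ s c → s * c * curlyAt p a (suc k) v)
             (sgn-fOf≡sign∤ p isPrime u) (curlyAt≡prod∤ (ι (+ 1)) (suc k) u) ⟩
      sign∤ u * prod∤ (λ v → v) 1ℤ 1ℤ u * curlyAt p a (suc k) v
    ≡⟨ cong (_* curlyAt p a (suc k) v) (prod∤-neg 1ℤ 1ℤ u) ⟨
      prod∤ -_ 1ℤ 1ℤ u * curlyAt p a (suc k) v
    ≈⟨ *-cong (≈-reflexive {prod∤ -_ 1ℤ 1ℤ u} refl)
              (≈-trans (≈-reflexive (curlyAt≡prod∤ a (suc k) v))
                       (prod∤-reflect p∣N (approx≡approx₁-mod-p a k) v (+ u) N∣a+v+u)) ⟩
      prod∤ -_ 1ℤ 1ℤ u * prod∤ -_ (1ℤ + + u) (1ℤ + + u) v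
    ≡⟨ prod∤-+ -_ 1ℤ 1ℤ u v ⟨
      prod∤ -_ 1ℤ 1ℤ (u ℕ.+ v) ∎
    where
    open import Relation.Binary.Reasoning.Setoid ≈-setoid

lemma3p4 : (p : ℕ) .{{_ : NonZero p}} → Prime p →
    (a : ℤ[ p ]) →
    ¬ (∃ λ m → ∀ k → (+ (p ^ k)) ∣ (approx a k + + m)) →
    (n : ℕ) → n ≥ 1 → (x y : ℕ) →
    (+ (p ^ n)) ∣ (+ x + + y + approx a n) →
    (+ (p ^ n)) ∣ (sgn (fOf p x) * curlyAt p (ι (+ 1)) n x * curlyAt p a n y
                   - sgn (fOf p y) * curlyAt p (ι (+ 1)) n y * curlyAt p a n x)
lemma3p4 p isPrime a _ (suc n) _ x y pⁿ∣x+y+a = S.∣⇒∣ᵤ (divides (≈-trans lhs≈ (≈-sym rhs≈)))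
  where
  N = + (p ^ suc n)
  A = approx a (suc n)
  open Prod∤ p
  open Congruence N
  p∣N : + p S.∣ N
  p∣N = S.∣ᵤ⇒∣ {+ p} {N} (ℕD.m∣m*n (p ^ n))
  N∣x+y+a : N S.∣ (+ x + + y + A)
  N∣x+y+a = S.∣ᵤ⇒∣ pⁿ∣x+y+a
  swap : ∀ X Y Z → X + Y + Z ≡ Z + Y + X
  swap = solve-∀
  rotate : ∀ X Y Z → X + Y + Z ≡ Z + X + Y
  rotate = solve-∀
  side : ℕ → ℕ → ℤ
  side u v = sgn (fOf p u) * curlyAt p (ι (+ 1)) (suc n) u * curlyAt p a (suc n) v
  lhs≈ : side x y ≈ prod∤ -_ 1ℤ 1ℤ (x ℕ.+ y)
  lhs≈ = signed-curly≈prod∤ p isPrime a n p∣N x y (subst (N S.∣_) (swap (+ x) (+ y) A) N∣x+y+a)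
  rhs≈ : side y x ≈ prod∤ -_ 1ℤ 1ℤ (x ℕ.+ y)
  rhs≈ = subst (λ m → side y x ≈ prod∤ -_ 1ℤ 1ℤ m) (ℕP.+-comm y x)
           (signed-curly≈prod∤ p isPrime a n p∣N y x (subst (N S.∣_) (rotate (+ x) (+ y) A) N∣x+y+a))
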